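{- Let $\alpha>1$ be an integer with $\alpha\equiv 2\pmod 3$. Then for every $a\in\mathbb{N}$ (with $a\ge1$), $$S_3^1(a)\le 1.3\,a^{\log_3 2}.$$
   Context: A base-$3$ digit is called large if it is greater than $3/2$ (i.e. equals $2$). $S_3^1(a)=\#\{0\le s<a : \text{the base- }3\text{ representation of }\alpha^s\text{ contains no large digit}\}$. -}

module Defs where

open import Data.Nat using (ℕ; zero; suc; _+_; _*_; _^_; _/_; _%_; _<ᵇ_)
open import Data.Bool using (Bool; true; false; not; if_then_else_)
open import Data.List using (List; []; _∷_; upTo)
open import Data.Bool.ListAction using (any)

-- Fuel n suffices since n has at most n base-3 digits; 0 has the empty
-- representation (no digits at all, in particular no large digit).
digits3-fuel : ℕ → ℕ → List ℕ
digits3-fuel zero    _       = []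
digits3-fuel (suc f) zero    = []
digits3-fuel (suc f) (suc m) = (suc m % 3) ∷ digits3-fuel f (suc m / 3)

digits3 : ℕ → List ℕ
digits3 n = digits3-fuel n n

-- A base-3 digit d is large iff d > 3/2, i.e. 2 * d > 3.
isLarge : ℕ → Bool
isLarge d = 3 <ᵇ 2 * d

noLargeDigit : ℕ → Bool
noLargeDigit n = not (any isLarge (digits3 n))

countB : (ℕ → Bool) → List ℕ → ℕ
countB p []       = 0
countB p (x ∷ xs) = (if p x then 1 else 0) + countB p xs

S31 : ℕ → ℕ → ℕ
S31 α a = countB (λ s → noLargeDigit (α ^ s)) (upTo a)

{-# OPTIONS --safe #-}
module Submission where

-- Odd powers of α are ≡ 2 (mod 3), so only the powers β^t of β = α² can count, and
-- β = 1 + 3^(k+1) u with 3 ∤ u. Then β^(3^j) = 1 + 3^(j+k+1) u_j with u_j ≡ u (mod 3), and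
-- multiplying by it fixes the lowest j+k+1 base-3 digits while adding u (mod 3) to the next
-- one. Hence among β^t, β^(t+3^j), β^(t+2·3^j) that digit takes all three values, one of them
-- large, and by induction at most 2^j of β^0, …, β^(3^j − 1) have their lowest j+k+1 digits
-- all small. This gives S_3^1(a) ≤ 2^m for a ≤ 2·3^m; with 2·3^(m−1) < a the claim reduces
-- to 20^q ≤ 13^q 2^p, which follows from 3^5 < 2^8 and 20^8 ≤ 13^8 · 2^5.

open import Defs
open import Data.Nat using (ℕ; _*_; _^_; _%_; _<_; _≤_)
open import Relation.Binary.PropositionalEquality using (_≡_)
open import Data.Bool using (Bool; true; false; not; _∧_; T; if_then_else_)
open import Data.Bool.ListAction using (any)
open import Data.Bool.Properties using (∧-assoc; ∧-identityʳ)
open import Data.Empty using (⊥-elim)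
open import Data.List using (applyUpTo)
open import Data.Nat using (zero; suc; _+_; _∸_; _/_; _≤?_; z≤n; s≤s; NonZero; >-nonZero)
open import Data.Nat.DivMod
open import Data.Nat.Divisibility
  using (_∤_; _∣?_; divides; ∣m+n∣m⇒∣n; m∣m*n; n∣m*n; m%n≡0⇒n∣m; quotient-<; quotient≢0)
open import Data.Nat.Induction using (<-rec)
open import Data.Nat.Properties
open import Data.Nat.Tactic.RingSolver using (solve-∀)
open import Data.Product using (∃-syntax; _×_; _,_; proj₁; proj₂)
open import Data.Sum using (_⊎_; inj₁; inj₂)
open import Function using (_∘_; id)
open import Relation.Binary.PropositionalEquality
  using (_≢_; refl; sym; trans; cong; cong₂; subst; module ≡-Reasoning)
open import Relation.Nullary using (yes; no)
open import Algebra.Properties.CommutativeSemigroup +-commutativeSemigroup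
  using () renaming (interchange to +-interchange)
open import Algebra.Properties.CommutativeSemigroup *-commutativeSemigroup
  using () renaming (interchange to *-interchange)

𝟙 : Bool → ℕ
𝟙 b = if b then 1 else 0

𝟙≤1 : ∀ b → 𝟙 b ≤ 1
𝟙≤1 true  = ≤-refl
𝟙≤1 false = z≤n

𝟙-mono : ∀ {b c} → (T b → T c) → 𝟙 b ≤ 𝟙 c
𝟙-mono {false}         _   = z≤n
𝟙-mono {true}  {true}  _   = ≤-refl
𝟙-mono {true}  {false} b⇒c = ⊥-elim (b⇒c _)

∑< : ℕ → (ℕ → ℕ) → ℕ
∑< zero    f = 0
∑< (suc n) f = f 0 + ∑< n (f ∘ suc)

syntax ∑< n (λ i → e) = ∑[ i < n ] e

countB-applyUpTo : ∀ p f n → countB p (applyUpTo f n) ≡ ∑[ i < n ] 𝟙 (p (f i))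
countB-applyUpTo p f zero    = refl
countB-applyUpTo p f (suc n) = cong (𝟙 (p (f 0)) +_) (countB-applyUpTo p (f ∘ suc) n)

∑-cong : ∀ {f g} n → (∀ i → f i ≡ g i) → ∑< n f ≡ ∑< n g
∑-cong zero    f≡g = refl
∑-cong (suc n) f≡g = cong₂ _+_ (f≡g 0) (∑-cong n (f≡g ∘ suc))

∑-monoʳ-≤ : ∀ {f g} n → (∀ i → f i ≤ g i) → ∑< n f ≤ ∑< n g
∑-monoʳ-≤ zero    f≤g = z≤n
∑-monoʳ-≤ (suc n) f≤g = +-mono-≤ (f≤g 0) (∑-monoʳ-≤ n (f≤g ∘ suc))

∑-distrib-+ : ∀ f g n → ∑[ i < n ] (f i + g i) ≡ ∑< n f + ∑< n g
∑-distrib-+ f g zero    = refl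
∑-distrib-+ f g (suc n) =
  trans (cong (f 0 + g 0 +_) (∑-distrib-+ (f ∘ suc) (g ∘ suc) n)) (+-interchange (f 0) (g 0) _ _)

∑-split : ∀ f m n → ∑< (m + n) f ≡ ∑< m f + ∑[ i < n ] f (m + i)
∑-split f zero    n = refl
∑-split f (suc m) n = trans (cong (f 0 +_) (∑-split (f ∘ suc) m n)) (sym (+-assoc (f 0) _ _))

∑-monoˡ-≤ : ∀ f {m n} → m ≤ n → ∑< m f ≤ ∑< n f
∑-monoˡ-≤ f {m} {n} m≤n = begin
  ∑< m f                             ≤⟨ m≤m+n _ _ ⟩
  ∑< m f + ∑[ i < n ∸ m ] f (m + i)  ≡⟨ ∑-split f m (n ∸ m) ⟨
  ∑< (m + (n ∸ m)) f                 ≡⟨ cong (λ k → ∑< k f) (m+[n∸m]≡n m≤n) ⟩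
  ∑< n f                             ∎
  where open ≤-Reasoning

∑-triples : ∀ f n → ∑< (3 * n) f ≡ ∑[ i < n ] (f i + (f (n + i) + f (n + (n + i))))
∑-triples f n = begin
  ∑< (3 * n) f
    ≡⟨ cong (λ k → ∑< (n + (n + k)) f) (+-identityʳ n) ⟩
  ∑< (n + (n + n)) f
    ≡⟨ ∑-split f n (n + n) ⟩
  ∑< n f + ∑[ i < n + n ] f (n + i)
    ≡⟨ cong (∑< n f +_) (∑-split (λ i → f (n + i)) n n) ⟩
  ∑< n f + (∑[ i < n ] f (n + i) + ∑[ i < n ] f (n + (n + i)))
    ≡⟨ cong (∑< n f +_) (∑-distrib-+ (λ i → f (n + i)) (λ i → f (n + (n + i))) n) ⟨
  ∑< n f + ∑[ i < n ] (f (n + i) + f (n + (n + i)))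
    ≡⟨ ∑-distrib-+ f _ n ⟨
  ∑[ i < n ] (f i + (f (n + i) + f (n + (n + i)))) ∎
  where open ≡-Reasoning

∑-pairs : ∀ f n → ∑< (n + n) f ≡ ∑[ i < n ] (f (2 * i) + f (suc (2 * i)))
∑-pairs f zero    = refl
∑-pairs f (suc n) = begin
  f 0 + ∑< (n + suc n) (f ∘ suc)
    ≡⟨ cong (λ k → f 0 + ∑< k (f ∘ suc)) (+-suc n n) ⟩
  f 0 + (f 1 + ∑< (n + n) (f ∘ suc ∘ suc))
    ≡⟨ cong (λ s → f 0 + (f 1 + s)) (∑-pairs (f ∘ suc ∘ suc) n) ⟩
  f 0 + (f 1 + ∑[ i < n ] (f (2 + 2 * i) + f (3 + 2 * i)))
    ≡⟨ +-assoc (f 0) (f 1) _ ⟨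
  f 0 + f 1 + ∑[ i < n ] (f (2 + 2 * i) + f (3 + 2 * i))
    ≡⟨ cong (f 0 + f 1 +_) (∑-cong n (λ i → cong (λ k → f k + f (suc k)) (*-suc 2 i))) ⟨
  f 0 + f 1 + ∑[ i < n ] (f (2 * suc i) + f (suc (2 * suc i))) ∎
  where open ≡-Reasoning

[m%d+n]%d≡[m+n]%d : ∀ m n d .{{_ : NonZero d}} → (m % d + n) % d ≡ (m + n) % d
[m%d+n]%d≡[m+n]%d m n d = begin
  (m % d + n) % d          ≡⟨ %-distribˡ-+ (m % d) n d ⟩
  (m % d % d + n % d) % d  ≡⟨ cong (λ x → (x + n % d) % d) (m%n%n≡m%n m d) ⟩
  (m % d + n % d) % d      ≡⟨ %-distribˡ-+ m n d ⟨
  (m + n) % d              ∎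
  where open ≡-Reasoning

[m+n%d]%d≡[m+n]%d : ∀ m n d .{{_ : NonZero d}} → (m + n % d) % d ≡ (m + n) % d
[m+n%d]%d≡[m+n]%d m n d = begin
  (m + n % d) % d  ≡⟨ cong (_% d) (+-comm m (n % d)) ⟩
  (n % d + m) % d  ≡⟨ [m%d+n]%d≡[m+n]%d n m d ⟩
  (n + m) % d      ≡⟨ cong (_% d) (+-comm n m) ⟩
  (m + n) % d      ∎
  where open ≡-Reasoning

m*n%d≡m%d : ∀ m n d .{{_ : NonZero d}} → n % d ≡ 1 → (m * n) % d ≡ m % d
m*n%d≡m%d m n d n%d≡1 = begin
  (m * n) % d            ≡⟨ %-distribˡ-* m n d ⟩
  (m % d * (n % d)) % d  ≡⟨ cong (λ x → (m % d * x) % d) n%d≡1 ⟩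
  (m % d * 1) % d        ≡⟨ cong (_% d) (*-identityʳ (m % d)) ⟩
  m % d % d              ≡⟨ m%n%n≡m%n m d ⟩
  m % d                  ∎
  where open ≡-Reasoning

^%3≡1 : ∀ {m} → m % 3 ≡ 1 → ∀ t → m ^ t % 3 ≡ 1
^%3≡1     m%3≡1 zero    = refl
^%3≡1 {m} m%3≡1 (suc t) = trans (m*n%d≡m%d m (m ^ t) 3 (^%3≡1 m%3≡1 t)) m%3≡1

3^[1+L]*w≡3^L*w*3 : ∀ L w → 3 ^ suc L * w ≡ 3 ^ L * w * 3
3^[1+L]*w≡3^L*w*3 L w = trans (*-assoc 3 (3 ^ L) w) (*-comm 3 (3 ^ L * w))

[n+3^[1+L]*w]%3≡n%3 : ∀ L n w → (n + 3 ^ suc L * w) % 3 ≡ n % 3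
[n+3^[1+L]*w]%3≡n%3 L n w =
  trans (cong (λ x → (n + x) % 3) (3^[1+L]*w≡3^L*w*3 L w)) ([m+kn]%n≡m%n n (3 ^ L * w) 3)

[n+3^[1+L]*w]/3≡n/3+3^L*w : ∀ L n w → (n + 3 ^ suc L * w) / 3 ≡ n / 3 + 3 ^ L * w
[n+3^[1+L]*w]/3≡n/3+3^L*w L n w = begin
  (n + 3 ^ suc L * w) / 3        ≡⟨ cong (λ x → (n + x) / 3) (3^[1+L]*w≡3^L*w*3 L w) ⟩
  (n + 3 ^ L * w * 3) / 3        ≡⟨ +-distrib-/-∣ʳ n (n∣m*n (3 ^ L * w)) ⟩
  n / 3 + 3 ^ L * w * 3 / 3      ≡⟨ cong (n / 3 +_) (m*n/n≡m (3 ^ L * w) 3) ⟩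
  n / 3 + 3 ^ L * w              ∎
  where open ≡-Reasoning

small : ℕ → Bool
small d = not (isLarge d)

-- Digits are indexed from the least significant one, digit 0.
digit : ℕ → ℕ → ℕ
digit zero    n = n % 3
digit (suc L) n = digit L (n / 3)

lowDigitsSmall : ℕ → ℕ → Bool
lowDigitsSmall zero    n = true
lowDigitsSmall (suc L) n = small (n % 3) ∧ lowDigitsSmall L (n / 3)

digit<3 : ∀ L n → digit L n < 3
digit<3 zero    n = m%n<n n 3
digit<3 (suc L) n = digit<3 L (n / 3)

lowDigitsSmall-suc : ∀ L n → lowDigitsSmall (suc L) n ≡ lowDigitsSmall L n ∧ small (digit L n)
lowDigitsSmall-suc zero    n = ∧-identityʳ (small (n % 3))
lowDigitsSmall-suc (suc L) n =
  trans (cong (small (n % 3) ∧_) (lowDigitsSmall-suc L (n / 3))) (sym (∧-assoc (small (n % 3)) _ _))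

lowDigitsSmall-0 : ∀ L → T (lowDigitsSmall L 0)
lowDigitsSmall-0 zero    = _
lowDigitsSmall-0 (suc L) = lowDigitsSmall-0 L

noLargeDigit⇒lowDigitsSmall : ∀ L n → T (noLargeDigit n) → T (lowDigitsSmall L n)
noLargeDigit⇒lowDigitsSmall L n = go L n n ≤-refl
  where
  go : ∀ L fuel n → n ≤ fuel → T (not (any isLarge (digits3-fuel fuel n))) → T (lowDigitsSmall L n)
  go zero    _          _       _            _ = _
  go (suc L) _          zero    _            _ = lowDigitsSmall-0 L
  go (suc L) zero       (suc m) ()           _
  go (suc L) (suc fuel) (suc m) (s≤s m≤fuel) h with isLarge (suc m % 3)
  ... | true  = ⊥-elim h
  ... | false = go L fuel (suc m / 3) (≤-trans (≤-pred (m/n<m (suc m) 3 (s≤s (s≤s z≤n)))) m≤fuel) h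

noLargeDigit-%3≡2 : ∀ n → n % 3 ≡ 2 → noLargeDigit n ≡ false
noLargeDigit-%3≡2 (suc m) n%3≡2 rewrite n%3≡2 = refl

lowDigitsSmall-+3^L* : ∀ L n w → lowDigitsSmall L (n + 3 ^ L * w) ≡ lowDigitsSmall L n
lowDigitsSmall-+3^L* zero    n w = refl
lowDigitsSmall-+3^L* (suc L) n w = begin
  small ((n + 3 ^ suc L * w) % 3) ∧ lowDigitsSmall L ((n + 3 ^ suc L * w) / 3)
    ≡⟨ cong₂ (λ r q → small r ∧ lowDigitsSmall L q)
             ([n+3^[1+L]*w]%3≡n%3 L n w) ([n+3^[1+L]*w]/3≡n/3+3^L*w L n w) ⟩
  small (n % 3) ∧ lowDigitsSmall L (n / 3 + 3 ^ L * w)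
    ≡⟨ cong (small (n % 3) ∧_) (lowDigitsSmall-+3^L* L (n / 3) w) ⟩
  small (n % 3) ∧ lowDigitsSmall L (n / 3) ∎
  where open ≡-Reasoning

digit-+3^L* : ∀ L n w → digit L (n + 3 ^ L * w) ≡ (digit L n + w) % 3
digit-+3^L* zero    n w = trans (cong (λ x → (n + x) % 3) (*-identityˡ w)) (sym ([m%d+n]%d≡[m+n]%d n w 3))
digit-+3^L* (suc L) n w =
  trans (cong (digit L) ([n+3^[1+L]*w]/3≡n/3+3^L*w L n w)) (digit-+3^L* L (n / 3) w)

[1+3^L*u]*n≡n+3^L*[u*n] : ∀ L u n → (1 + 3 ^ L * u) * n ≡ n + 3 ^ L * (u * n)
[1+3^L*u]*n≡n+3^L*[u*n] L u n =
  trans (*-distribʳ-+ n 1 (3 ^ L * u)) (cong₂ _+_ (*-identityˡ n) (*-assoc (3 ^ L) u n))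

lowDigitsSmall-*[1+3^L*u] : ∀ L u n → lowDigitsSmall L ((1 + 3 ^ L * u) * n) ≡ lowDigitsSmall L n
lowDigitsSmall-*[1+3^L*u] L u n =
  trans (cong (lowDigitsSmall L) ([1+3^L*u]*n≡n+3^L*[u*n] L u n)) (lowDigitsSmall-+3^L* L n (u * n))

digit-*[1+3^L*u] : ∀ L u n → n % 3 ≡ 1 → digit L ((1 + 3 ^ L * u) * n) ≡ (digit L n + u % 3) % 3
digit-*[1+3^L*u] L u n n%3≡1 = begin
  digit L ((1 + 3 ^ L * u) * n)   ≡⟨ cong (digit L) ([1+3^L*u]*n≡n+3^L*[u*n] L u n) ⟩
  digit L (n + 3 ^ L * (u * n))   ≡⟨ digit-+3^L* L n (u * n) ⟩
  (digit L n + u * n) % 3         ≡⟨ [m+n%d]%d≡[m+n]%d (digit L n) (u * n) 3 ⟨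
  (digit L n + u * n % 3) % 3     ≡⟨ cong (λ x → (digit L n + x) % 3) (m*n%d≡m%d u n 3 n%3≡1) ⟩
  (digit L n + u % 3) % 3         ∎
  where open ≡-Reasoning

[1+3^[1+L]*u]*n%3≡n%3 : ∀ L u n → (1 + 3 ^ suc L * u) * n % 3 ≡ n % 3
[1+3^[1+L]*u]*n%3≡n%3 L u n =
  trans (cong (_% 3) ([1+3^L*u]*n≡n+3^L*[u*n] (suc L) u n)) ([n+3^[1+L]*w]%3≡n%3 L n (u * n))

V₃[_-1]≡_ : ℕ → ℕ → Set
V₃[ γ -1]≡ e = ∃[ u ] γ ≡ 1 + 3 ^ e * u × 3 ∤ u

V₃⇒%3≡1 : ∀ {γ e} → V₃[ γ -1]≡ suc e → γ % 3 ≡ 1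
V₃⇒%3≡1 {e = e} (u , refl , _) = [n+3^[1+L]*w]%3≡n%3 e 1 u

3-adic-decomposition : ∀ c .{{_ : NonZero c}} → ∃[ k ] ∃[ u ] c ≡ 3 ^ k * u × 3 ∤ u
3-adic-decomposition = <-rec _ go
  where
  go : ∀ c → (∀ {c′} → c′ < c → .{{_ : NonZero c′}} → ∃[ k ] ∃[ u ] c′ ≡ 3 ^ k * u × 3 ∤ u) →
       .{{_ : NonZero c}} → ∃[ k ] ∃[ u ] c ≡ 3 ^ k * u × 3 ∤ u
  go c rec with 3 ∣? c
  ... | no 3∤c = 0 , c , sym (*-identityˡ c) , 3∤c
  ... | yes 3∣c@(divides q c≡q*3) with rec (quotient-< 3∣c) {{quotient≢0 3∣c}}
  ...   | k , u , q≡3^k*u , 3∤u = suc k , u , c≡3^[1+k]*u , 3∤u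
    where
    c≡3^[1+k]*u : c ≡ 3 ^ suc k * u
    c≡3^[1+k]*u = begin
      c                ≡⟨ c≡q*3 ⟩
      q * 3            ≡⟨ *-comm q 3 ⟩
      3 * q            ≡⟨ cong (3 *_) q≡3^k*u ⟩
      3 * (3 ^ k * u)  ≡⟨ *-assoc 3 (3 ^ k) u ⟨
      3 ^ suc k * u    ∎
      where open ≡-Reasoning

V₃-exists : ∀ {γ} → 1 < γ → γ % 3 ≡ 1 → ∃[ e ] V₃[ γ -1]≡ suc e
V₃-exists {1} (s≤s ())
V₃-exists {2} _ ()
V₃-exists {γ@(suc (suc (suc _)))} _ γ%3≡1
  with 3-adic-decomposition (γ / 3) {{>-nonZero (m≥n⇒m/n>0 {γ} {3} (s≤s (s≤s (s≤s z≤n))))}}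
... | k , u , γ/3≡3^k*u , 3∤u = k , u , γ≡1+3^[1+k]*u , 3∤u
  where
  γ≡1+3^[1+k]*u : γ ≡ 1 + 3 ^ suc k * u
  γ≡1+3^[1+k]*u = begin
    γ                    ≡⟨ m≡m%n+[m/n]*n γ 3 ⟩
    γ % 3 + γ / 3 * 3    ≡⟨ cong₂ (λ r c → r + c * 3) γ%3≡1 γ/3≡3^k*u ⟩
    1 + 3 ^ k * u * 3    ≡⟨ cong (1 +_) (3^[1+L]*w≡3^L*w*3 k u) ⟨
    1 + 3 ^ suc k * u    ∎
    where open ≡-Reasoning

-- x * (x * (x * 1)) is x ^ 3 unfolded, which is the form the ring solver accepts.
cube-expansion : ∀ P u → let x = 1 + 3 * P * u in
  x * (x * (x * 1)) ≡ 1 + 3 * (3 * P) * (3 * (P * u * u + P * P * u * u * u) + u)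
cube-expansion = solve-∀

V₃-^3 : ∀ {γ e} → V₃[ γ -1]≡ suc e → V₃[ γ ^ 3 -1]≡ suc (suc e)
V₃-^3 {e = e} (u , refl , 3∤u) =
  3 * w + u , cube-expansion (3 ^ e) u , λ 3∣3w+u → 3∤u (∣m+n∣m⇒∣n 3∣3w+u (m∣m*n w))
  where w = 3 ^ e * u * u + 3 ^ e * 3 ^ e * u * u * u

V₃-^3^ : ∀ {γ e} → V₃[ γ -1]≡ suc e → ∀ j → V₃[ γ ^ 3 ^ j -1]≡ suc (j + e)
V₃-^3^ {γ} {e} γv zero    = subst (λ x → V₃[ x -1]≡ suc e) (sym (^-identityʳ γ)) γv
V₃-^3^ {γ} {e} γv (suc j) =
  subst (λ x → V₃[ x -1]≡ suc (suc j + e)) [γ^3^j]^3≡γ^3^[1+j] (V₃-^3 {e = j + e} (V₃-^3^ γv j))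
  where
  [γ^3^j]^3≡γ^3^[1+j] : (γ ^ 3 ^ j) ^ 3 ≡ γ ^ 3 ^ suc j
  [γ^3^j]^3≡γ^3^[1+j] = trans (^-*-assoc γ (3 ^ j) 3) (cong (γ ^_) (*-comm (3 ^ j) 3))

-- d, d + e and d + 2e run through all residues mod 3, one of which is the large digit 2.
atMostTwoSmall : ∀ {d e} → d < 3 → e < 3 → e ≢ 0 →
  𝟙 (small d) + (𝟙 (small ((d + e) % 3)) + 𝟙 (small (((d + e) % 3 + e) % 3))) ≤ 2
atMostTwoSmall {e = 0} _ _ e≢0 = ⊥-elim (e≢0 refl)
atMostTwoSmall {0} {1} _ _ _ = ≤-refl
atMostTwoSmall {0} {2} _ _ _ = ≤-refl
atMostTwoSmall {1} {1} _ _ _ = ≤-refl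
atMostTwoSmall {1} {2} _ _ _ = ≤-refl
atMostTwoSmall {2} {1} _ _ _ = ≤-refl
atMostTwoSmall {2} {2} _ _ _ = ≤-refl
atMostTwoSmall {suc (suc (suc _))} (s≤s (s≤s (s≤s ()))) _ _
atMostTwoSmall {_} {suc (suc (suc _))} _ (s≤s (s≤s (s≤s ()))) _

𝟙-∧-≤ : ∀ b c₁ c₂ c₃ → 𝟙 c₁ + (𝟙 c₂ + 𝟙 c₃) ≤ 2 →
  𝟙 (b ∧ c₁) + (𝟙 (b ∧ c₂) + 𝟙 (b ∧ c₃)) ≤ 𝟙 b + 𝟙 b
𝟙-∧-≤ false _ _ _ _ = z≤n
𝟙-∧-≤ true  _ _ _ h = h

lowDigitsSmall-orbit : ∀ {z L} → V₃[ z -1]≡ suc L → ∀ n → n % 3 ≡ 1 →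
  let P = lowDigitsSmall (2 + L) in
  𝟙 (P n) + (𝟙 (P (z * n)) + 𝟙 (P (z * (z * n))))
    ≤ 𝟙 (lowDigitsSmall (suc L) n) + 𝟙 (lowDigitsSmall (suc L) n)
lowDigitsSmall-orbit {L = L} (u , refl , 3∤u) n n%3≡1 = begin
  𝟙 (P n) + (𝟙 (P (z * n)) + 𝟙 (P (z * (z * n))))
    ≡⟨ cong₂ _+_ (cong 𝟙 (lowDigitsSmall-suc (suc L) n)) (cong₂ _+_ (cong 𝟙 Pzn) (cong 𝟙 Pzzn)) ⟩
  𝟙 (b ∧ small d) + (𝟙 (b ∧ small ((d + e) % 3)) + 𝟙 (b ∧ small (((d + e) % 3 + e) % 3)))
    ≤⟨ 𝟙-∧-≤ b _ _ _ (atMostTwoSmall (digit<3 (suc L) n) (m%n<n u 3) (3∤u ∘ m%n≡0⇒n∣m u 3)) ⟩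
  𝟙 b + 𝟙 b ∎
  where
  open ≤-Reasoning
  z = 1 + 3 ^ suc L * u
  P = lowDigitsSmall (2 + L)
  b = lowDigitsSmall (suc L) n
  d = digit (suc L) n
  e = u % 3
  zn%3≡1 : z * n % 3 ≡ 1
  zn%3≡1 = trans ([1+3^[1+L]*u]*n%3≡n%3 L u n) n%3≡1
  zDigit : ∀ m → m % 3 ≡ 1 → digit (suc L) (z * m) ≡ (digit (suc L) m + e) % 3
  zDigit = digit-*[1+3^L*u] (suc L) u
  Pzn : P (z * n) ≡ b ∧ small ((d + e) % 3)
  Pzn = trans (lowDigitsSmall-suc (suc L) (z * n))
              (cong₂ _∧_ (lowDigitsSmall-*[1+3^L*u] (suc L) u n) (cong small (zDigit n n%3≡1)))
  Pzzn : P (z * (z * n)) ≡ b ∧ small (((d + e) % 3 + e) % 3)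
  Pzzn = trans (lowDigitsSmall-suc (suc L) (z * (z * n)))
               (cong₂ _∧_ (trans (lowDigitsSmall-*[1+3^L*u] (suc L) u (z * n)) (lowDigitsSmall-*[1+3^L*u] (suc L) u n))
                          (cong small (trans (zDigit (z * n) zn%3≡1) (cong (λ x → (x + e) % 3) (zDigit n n%3≡1)))))

lowDigitsSmall-count : ∀ {β k} → V₃[ β -1]≡ suc k → ∀ j →
  ∑[ t < 3 ^ j ] 𝟙 (lowDigitsSmall (suc j + k) (β ^ t)) ≤ 2 ^ j
lowDigitsSmall-count βv zero = ≤-trans (≤-reflexive (+-identityʳ _)) (𝟙≤1 _)
lowDigitsSmall-count {β} {k} βv (suc j) = begin
  ∑< (3 * X) F                                      ≡⟨ ∑-triples F X ⟩
  ∑[ t < X ] (F t + (F (X + t) + F (X + (X + t))))  ≤⟨ ∑-monoʳ-≤ X orbit ⟩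
  ∑[ t < X ] (G t + G t)                            ≡⟨ ∑-distrib-+ G G X ⟩
  ∑< X G + ∑< X G                                   ≤⟨ +-mono-≤ IH IH ⟩
  2 ^ j + 2 ^ j                                     ≡⟨ cong (2 ^ j +_) (+-identityʳ (2 ^ j)) ⟨
  2 ^ suc j                                         ∎
  where
  open ≤-Reasoning
  X = 3 ^ j
  F G : ℕ → ℕ
  F t = 𝟙 (lowDigitsSmall (2 + j + k) (β ^ t))
  G t = 𝟙 (lowDigitsSmall (suc j + k) (β ^ t))
  IH : ∑< X G ≤ 2 ^ j
  IH = lowDigitsSmall-count βv j
  orbit : ∀ t → F t + (F (X + t) + F (X + (X + t))) ≤ G t + G t
  orbit t rewrite ^-distribˡ-+-* β X (X + t) | ^-distribˡ-+-* β X t =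
    lowDigitsSmall-orbit {L = j + k} (V₃-^3^ {e = k} βv j) (β ^ t) (^%3≡1 (V₃⇒%3≡1 {e = k} βv) t)

S31≤2^ : ∀ {α} → 1 < α → α % 3 ≡ 2 → ∀ {a} m → a ≤ 2 * 3 ^ m → S31 α a ≤ 2 ^ m
S31≤2^ {α} 1<α α%3≡2 {a} m a≤2*3^m = begin
  S31 α a                                   ≡⟨ countB-applyUpTo (λ s → noLargeDigit (α ^ s)) id a ⟩
  ∑< a f                                    ≤⟨ ∑-monoˡ-≤ f (≤-trans a≤2*3^m (≤-reflexive 2*X≡X+X)) ⟩
  ∑< (X + X) f                              ≡⟨ ∑-pairs f X ⟩
  ∑[ t < X ] (f (2 * t) + f (suc (2 * t)))  ≤⟨ ∑-monoʳ-≤ X pair ⟩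
  ∑[ t < X ] 𝟙 (lowDigitsSmall L (β ^ t))   ≤⟨ lowDigitsSmall-count (proj₂ β-1) m ⟩
  2 ^ m                                     ∎
  where
  open ≤-Reasoning
  X = 3 ^ m
  β = α ^ 2
  f : ℕ → ℕ
  f s = 𝟙 (noLargeDigit (α ^ s))
  2*X≡X+X : 2 * X ≡ X + X
  2*X≡X+X = cong (X +_) (+-identityʳ X)
  β%3≡1 : β % 3 ≡ 1
  β%3≡1 = trans (%-distribˡ-* α (α * 1) 3)
                (cong₂ (λ x y → x * y % 3) α%3≡2 (trans (cong (_% 3) (*-identityʳ α)) α%3≡2))
  β-1 : ∃[ k ] V₃[ β -1]≡ suc k
  β-1 = V₃-exists (^-monoˡ-< 2 1<α) β%3≡1
  L = suc m + proj₁ β-1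
  α^2t≡β^t : ∀ t → α ^ (2 * t) ≡ β ^ t
  α^2t≡β^t t = sym (^-*-assoc α 2 t)
  α^[1+2t]%3≡2 : ∀ t → α ^ suc (2 * t) % 3 ≡ 2
  α^[1+2t]%3≡2 t =
    trans (m*n%d≡m%d α _ 3 (trans (cong (_% 3) (α^2t≡β^t t)) (^%3≡1 β%3≡1 t))) α%3≡2
  pair : ∀ t → f (2 * t) + f (suc (2 * t)) ≤ 𝟙 (lowDigitsSmall L (β ^ t))
  pair t = begin
    f (2 * t) + f (suc (2 * t))  ≡⟨ cong₂ _+_ (cong (𝟙 ∘ noLargeDigit) (α^2t≡β^t t))
                                              (cong 𝟙 (noLargeDigit-%3≡2 (α ^ suc (2 * t)) (α^[1+2t]%3≡2 t))) ⟩
    𝟙 (noLargeDigit (β ^ t)) + 0  ≡⟨ +-identityʳ _ ⟩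
    𝟙 (noLargeDigit (β ^ t))      ≤⟨ 𝟙-mono (noLargeDigit⇒lowDigitsSmall L (β ^ t)) ⟩
    𝟙 (lowDigitsSmall L (β ^ t))  ∎

^-distribʳ-* : ∀ m n o → (m * n) ^ o ≡ m ^ o * n ^ o
^-distribʳ-* m n zero    = refl
^-distribʳ-* m n (suc o) = trans (cong (m * n *_) (^-distribʳ-* m n o)) (*-interchange m n (m ^ o) (n ^ o))

[m^n]^o≡[m^o]^n : ∀ m n o → (m ^ n) ^ o ≡ (m ^ o) ^ n
[m^n]^o≡[m^o]^n m n o = trans (^-*-assoc m n o) (trans (cong (m ^_) (*-comm n o)) (sym (^-*-assoc m o n)))

^-cancelʳ-≤ : ∀ n .{{_ : NonZero n}} {m o} → m ^ n ≤ o ^ n → m ≤ o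
^-cancelʳ-≤ n m^n≤o^n = ≮⇒≥ (λ o<m → <⇒≱ (^-monoˡ-< n o<m) m^n≤o^n)

8p≤5q⇒3^p≤2^q : ∀ p q → 8 * p ≤ 5 * q → 3 ^ p ≤ 2 ^ q
8p≤5q⇒3^p≤2^q p q 8p≤5q = ^-cancelʳ-≤ 8 (begin
  (3 ^ p) ^ 8  ≡⟨ [m^n]^o≡[m^o]^n 3 p 8 ⟩
  (3 ^ 8) ^ p  ≡⟨ ^-*-assoc 3 8 p ⟩
  3 ^ (8 * p)  ≤⟨ ^-monoʳ-≤ 3 8p≤5q ⟩
  3 ^ (5 * q)  ≡⟨ ^-*-assoc 3 5 q ⟨
  (3 ^ 5) ^ q  ≤⟨ ^-monoˡ-≤ q (≤ᵇ⇒≤ (3 ^ 5) (2 ^ 8) _) ⟩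
  (2 ^ 8) ^ q  ≡⟨ [m^n]^o≡[m^o]^n 2 8 q ⟩
  (2 ^ q) ^ 8  ∎)
  where open ≤-Reasoning

2^q<3^p⇒5q<8p : ∀ p q → 2 ^ q < 3 ^ p → 5 * q < 8 * p
2^q<3^p⇒5q<8p p q 2^q<3^p = ≰⇒> (λ 8p≤5q → <⇒≱ 2^q<3^p (8p≤5q⇒3^p≤2^q p q 8p≤5q))

-- With 20 = 10 · 2, this is where the constant 1.3 comes from: 20^8 ≤ 13^8 · 2^5 and 5/8 < log₃ 2.
20^q≤13^q*2^p : ∀ p q → 2 ^ q < 3 ^ p → 20 ^ q ≤ 13 ^ q * 2 ^ p
20^q≤13^q*2^p p q 2^q<3^p = ^-cancelʳ-≤ 8 (begin
  (20 ^ q) ^ 8                ≡⟨ [m^n]^o≡[m^o]^n 20 q 8 ⟩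
  (20 ^ 8) ^ q                ≤⟨ ^-monoˡ-≤ q (≤ᵇ⇒≤ (20 ^ 8) (13 ^ 8 * 2 ^ 5) _) ⟩
  (13 ^ 8 * 2 ^ 5) ^ q        ≡⟨ ^-distribʳ-* (13 ^ 8) (2 ^ 5) q ⟩
  (13 ^ 8) ^ q * (2 ^ 5) ^ q  ≡⟨ cong₂ _*_ ([m^n]^o≡[m^o]^n 13 8 q) (^-*-assoc 2 5 q) ⟩
  (13 ^ q) ^ 8 * 2 ^ (5 * q)  ≤⟨ *-monoʳ-≤ ((13 ^ q) ^ 8) (^-monoʳ-≤ 2 (<⇒≤ (2^q<3^p⇒5q<8p p q 2^q<3^p))) ⟩
  (13 ^ q) ^ 8 * 2 ^ (8 * p)  ≡⟨ cong ((13 ^ q) ^ 8 *_) (trans ([m^n]^o≡[m^o]^n 2 p 8) (^-*-assoc 2 8 p)) ⟨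
  (13 ^ q) ^ 8 * (2 ^ p) ^ 8  ≡⟨ ^-distribʳ-* (13 ^ q) (2 ^ p) 8 ⟨
  (13 ^ q * 2 ^ p) ^ 8        ∎)
  where open ≤-Reasoning

S≤1⇒[10S]^q≤13^q*a^p : ∀ {S a} p q → S ≤ 1 → 1 ≤ a → (10 * S) ^ q ≤ 13 ^ q * a ^ p
S≤1⇒[10S]^q≤13^q*a^p {S} {a} p q S≤1 1≤a = begin
  (10 * S) ^ q    ≤⟨ ^-monoˡ-≤ q (*-monoʳ-≤ 10 S≤1) ⟩
  10 ^ q          ≤⟨ ^-monoˡ-≤ q (m≤m+n 10 3) ⟩
  13 ^ q          ≡⟨ *-identityʳ (13 ^ q) ⟨
  13 ^ q * 1      ≤⟨ *-monoʳ-≤ (13 ^ q) (≤-trans (≤-reflexive (sym (^-zeroˡ p))) (^-monoˡ-≤ p 1≤a)) ⟩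
  13 ^ q * a ^ p  ∎
  where open ≤-Reasoning

S≤2^[1+m]⇒[10S]^q≤13^q*a^p : ∀ {S a} m p q → 2 ^ q < 3 ^ p → S ≤ 2 ^ suc m → 2 * 3 ^ m < a →
  (10 * S) ^ q ≤ 13 ^ q * a ^ p
S≤2^[1+m]⇒[10S]^q≤13^q*a^p {S} {a} m p q 2^q<3^p S≤2^[1+m] 2*3^m<a = begin
  (10 * S) ^ q                    ≤⟨ ^-monoˡ-≤ q (*-monoʳ-≤ 10 S≤2^[1+m]) ⟩
  (10 * (2 * 2 ^ m)) ^ q          ≡⟨ cong (_^ q) (*-assoc 10 2 (2 ^ m)) ⟨
  (20 * 2 ^ m) ^ q                ≡⟨ ^-distribʳ-* 20 (2 ^ m) q ⟩
  20 ^ q * (2 ^ m) ^ q            ≤⟨ *-mono-≤ (20^q≤13^q*2^p p q 2^q<3^p) (≤-reflexive ([m^n]^o≡[m^o]^n 2 m q)) ⟩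
  13 ^ q * 2 ^ p * (2 ^ q) ^ m    ≤⟨ *-monoʳ-≤ (13 ^ q * 2 ^ p) (^-monoˡ-≤ m (<⇒≤ 2^q<3^p)) ⟩
  13 ^ q * 2 ^ p * (3 ^ p) ^ m    ≡⟨ *-assoc (13 ^ q) (2 ^ p) _ ⟩
  13 ^ q * (2 ^ p * (3 ^ p) ^ m)  ≡⟨ cong (λ x → 13 ^ q * (2 ^ p * x)) ([m^n]^o≡[m^o]^n 3 p m) ⟩
  13 ^ q * (2 ^ p * (3 ^ m) ^ p)  ≡⟨ cong (13 ^ q *_) (^-distribʳ-* 2 (3 ^ m) p) ⟨
  13 ^ q * (2 * 3 ^ m) ^ p        ≤⟨ *-monoʳ-≤ (13 ^ q) (^-monoˡ-≤ p (<⇒≤ 2*3^m<a)) ⟩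
  13 ^ q * a ^ p                  ∎
  where open ≤-Reasoning

1+2*3^m≤2*3^[1+m] : ∀ m → suc (2 * 3 ^ m) ≤ 2 * 3 ^ suc m
1+2*3^m≤2*3^[1+m] m = begin
  1 + 2 * X            ≤⟨ +-monoˡ-≤ (2 * X) (m^n>0 3 m) ⟩
  X + 2 * X            ≤⟨ m≤m+n (X + 2 * X) (3 * X) ⟩
  X + 2 * X + 3 * X    ≡⟨ six-X X ⟩
  2 * (3 * X)          ∎
  where
  open ≤-Reasoning
  X = 3 ^ m
  six-X : ∀ x → x + 2 * x + 3 * x ≡ 2 * (3 * x)
  six-X = solve-∀

bracket-2*3^ : ∀ a → a ≤ 2 ⊎ ∃[ m ] 2 * 3 ^ m < a × a ≤ 2 * 3 ^ suc m
bracket-2*3^ zero = inj₁ z≤n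
bracket-2*3^ (suc a) with bracket-2*3^ a
... | inj₁ a≤2 with suc a ≤? 2
...   | yes 1+a≤2 = inj₁ 1+a≤2
...   | no  1+a≰2 = inj₂ (0 , ≰⇒> 1+a≰2 , ≤-trans (s≤s a≤2) (m≤m+n 3 3))
bracket-2*3^ (suc a) | inj₂ (m , lo , hi) with suc a ≤? 2 * 3 ^ suc m
...   | yes 1+a≤ = inj₂ (m , m<n⇒m<1+n lo , 1+a≤)
...   | no  1+a≰ = inj₂ (suc m , ≰⇒> 1+a≰ , ≤-trans (s≤s hi) (1+2*3^m≤2*3^[1+m] (suc m)))

theorem2p13 : (α : ℕ) → 1 < α → α % 3 ≡ 2 → (a : ℕ) → 1 ≤ a →
    (p q : ℕ) → 1 ≤ q → 2 ^ q < 3 ^ p →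
    (10 * S31 α a) ^ q ≤ 13 ^ q * a ^ p
theorem2p13 α 1<α α%3≡2 a 1≤a p q _ 2^q<3^p with bracket-2*3^ a
... | inj₁ a≤2 =
  S≤1⇒[10S]^q≤13^q*a^p p q (S31≤2^ 1<α α%3≡2 0 a≤2) 1≤a
... | inj₂ (m , 2*3^m<a , a≤2*3^[1+m]) =
  S≤2^[1+m]⇒[10S]^q≤13^q*a^p m p q 2^q<3^p (S31≤2^ 1<α α%3≡2 (suc m) a≤2*3^[1+m]) 2*3^m<a
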